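{- Let $i$ be an index such that for every $x$ the limit $\lim_k\lim_s A_i(x,k,s)$ exists, and let $A_i$ be the set whose characteristic function is this limit; suppose $A_i$ is infinite and has weak apartness. Then there exists a finite set $X_i\subseteq A_i$ such that $$\exists K\ \forall k>K\ \exists s_k\ \forall s>s_k\ \forall w\in\mathbb{Z}^+\ \Big(\lambda(w)=k\wedge\mu(w)=s\ \longrightarrow\ \exists x\in X_i\ \big(R(\mu(x),w)=x\big)\Big).$$
   Context: For $x=\sum_{j=0}^{m}2^{n_j}\in\mathbb{Z}^+$ with $n_0<\dots<n_m$, $\mu(x)=n_m$, $\lambda(x)=n_0$; $B^n=\{x\in\mathbb{Z}^+:\mu(x)=n\}$. A set $A\subseteq\mathbb{Z}^+$ has weak apartness if for every $m$, $|B^m\cap A|\leq 1$, and for every $l$, at most two $x\in A$ have $\lambda(x)=l$. Let $\Phi_j$ be the $j$-th oracle Turing functional and $\emptyset'[s]$ the stage-$s$ approximation to the halting set; $A_j(x,k,s)=\Phi_j^{\emptyset'[s]}(x,k)[s]$ if this converges in $s$ steps with value in $\{0,1\}$, and $A_j(x,k,s)=0$ otherwise. Let $a_j(n,k,s)=\max\{A_j(x,k,s):x\in B^n\}$, and $C_j(k,s)$ the set of the first $2^j$ numbers $n$ with $j<n<s$ and $a_j(n,k,s)=1$ (or all such $n$ if fewer). For $n\in\mathbb{N}$ and $w\in\mathbb{Z}^+$ let $j=\min\big(\{i'<n: n\in C_{i'}(\lambda(w),\mu(w))\}\cup\{n\}\big)$ and $R(n,w)=\min\big(\{x\in B^n: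 A_j(x,\lambda(w),\mu(w))=1\}\cup\{2^{n+1}-1\}\big)$. -}

module Defs where

open import Data.Nat using (ℕ; zero; suc; _+_; _*_; _∸_; _^_; _≤_; _<_; _<ᵇ_; _≡ᵇ_; ⌊_/2⌋)
open import Data.Nat.Logarithm using (⌊log₂_⌋)
open import Data.Bool using (Bool; true; false; if_then_else_; _∨_; _∧_; not)
open import Data.Maybe using (Maybe; just; nothing)
open import Data.List using (List; []; _∷_; filterᵇ; take; foldr; map; upTo)
open import Data.Bool.ListAction using (any)
open import Data.Product using (Σ; _×_; ∃; ∃-syntax; _,_)
open import Data.Sum using (_⊎_)
open import Relation.Binary.PropositionalEquality using (_≡_)

-- Binary notions.  Positive integers are naturals x with 1 ≤ x.

μ : ℕ → ℕ
μ x = ⌊log₂ x ⌋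

-- λ(x) = position of the lowest 1-bit of x (for x ≥ 1); the first
-- argument of `tz` is fuel (λ x ≤ x, so fuel x suffices).
private
  isEven : ℕ → Bool
  isEven zero = true
  isEven (suc zero) = false
  isEven (suc (suc n)) = isEven n

  tz : ℕ → ℕ → ℕ
  tz zero n = zero
  tz (suc fuel) zero = zero
  tz (suc fuel) (suc n) =
    if isEven (suc n) then suc (tz fuel ⌊ suc n /2⌋) else zero

λ′ : ℕ → ℕ
λ′ x = tz x x

range : ℕ → ℕ → List ℕ
range a zero = []
range a (suc len) = a ∷ range (suc a) len

-- B^n = {x ∈ ℤ⁺ : μ(x) = n} = [2^n, 2^(n+1) - 1], as a list in increasing order
Blist : ℕ → List ℕ
Blist n = range (2 ^ n) (2 ^ n)

-- Oracle Turing functionals are taken abstractly: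
--   Φ j σ x k s = just v   iff  Φ_j^σ(x,k) converges within s steps with output v,
--   Φ j σ x k s = nothing  otherwise.
-- Hapx s : ℕ → Bool is the stage-s approximation ∅'[s] to the halting set.

Functionals : Set
Functionals = ℕ → (ℕ → Bool) → ℕ → ℕ → ℕ → Maybe ℕ

HaltApprox : Set
HaltApprox = ℕ → ℕ → Bool

-- A_j(x,k,s) ∈ {0,1}, coded as Bool (true = 1).  Output 1 gives 1; output 0,
-- divergence or output ∉ {0,1} gives 0.
Aapx : Functionals → HaltApprox → ℕ → ℕ → ℕ → ℕ → Bool
Aapx Φ H j x k s with Φ j (H s) x k s
... | just (suc zero) = true
... | _ = false

aapx : Functionals → HaltApprox → ℕ → ℕ → ℕ → ℕ → Bool
aapx Φ H j n k s = any (λ x → Aapx Φ H j x k s) (Blist n)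

Cset : Functionals → HaltApprox → ℕ → ℕ → ℕ → List ℕ
Cset Φ H j k s = take (2 ^ j) (filterᵇ (λ n → aapx Φ H j n k s) (range (suc j) (s ∸ suc j)))

memᵇ : ℕ → List ℕ → Bool
memᵇ n = any (λ m → m ≡ᵇ n)

firstOr : (ℕ → Bool) → ℕ → List ℕ → ℕ
firstOr p d [] = d
firstOr p d (y ∷ ys) = if p y then y else firstOr p d ys

jsel : Functionals → HaltApprox → ℕ → ℕ → ℕ
jsel Φ H n w = firstOr (λ i′ → memᵇ n (Cset Φ H i′ (λ′ w) (μ w))) n (upTo n)

R : Functionals → HaltApprox → ℕ → ℕ → ℕ
R Φ H n w = firstOr (λ x → Aapx Φ H (jsel Φ H n w) x (λ′ w) (μ w)) (2 ^ suc n ∸ 1) (Blist n)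

LimIs : (ℕ → Bool) → Bool → Set
LimIs f v = ∃[ s₀ ] (∀ s → s₀ < s → f s ≡ v)

-- lim_k lim_s f(k,s) = v : for all sufficiently large k the inner limit
-- exists, and these inner limits converge to v.
DoubleLimIs : (ℕ → ℕ → Bool) → Bool → Set
DoubleLimIs f v = ∃[ K ] (∀ k → K < k → LimIs (f k) v)

_∈ˢ_ : ℕ → (ℕ → Bool) → Set
x ∈ˢ χ = (1 ≤ x) × (χ x ≡ true)

Infinite : (ℕ → Bool) → Set
Infinite χ = ∀ N → ∃[ x ] (N < x × x ∈ˢ χ)

WeakApartness : (ℕ → Bool) → Set
WeakApartness χ =
  (∀ x y → x ∈ˢ χ → y ∈ˢ χ → μ x ≡ μ y → x ≡ y)
  × (∀ x y z → x ∈ˢ χ → y ∈ˢ χ → z ∈ˢ χ → λ′ x ≡ λ′ y → λ′ y ≡ λ′ z →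
       (x ≡ y) ⊎ ((x ≡ z) ⊎ (y ≡ z)))

module Submission where

open import Defs
open import Data.Nat using (ℕ; _≤_; _<_)
open import Data.Bool using (Bool)
open import Data.List using (List)
open import Data.List.Relation.Unary.All using (All)
open import Data.List.Relation.Unary.Any using (Any)
open import Data.Product using (_×_; ∃-syntax)
open import Relation.Binary.PropositionalEquality using (_≡_)

open import Data.Nat using (zero; suc; _+_; _∸_; _^_; _⊔_; z≤n; s≤s; z<s; s<s; s<s⁻¹; s≤s⁻¹; ⌊_/2⌋)
open import Data.Nat.Properties
open import Data.Nat.Logarithm using (⌊log₂⌋-mono-≤; ⌊log₂⌊n/2⌋⌋≡⌊log₂n⌋∸1; ⌊log₂[2^n]⌋≡n)
open import Data.Bool using (true; false)
open import Data.Bool.Properties using (T-≡)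
open import Data.Bool.ListAction using (any; or)
open import Data.List using ([]; _∷_; _++_; length; filterᵇ; take; map; applyUpTo)
open import Data.List.Properties using (length-++; length-take; length-removeAt′; filter-++; filter-some; map-cong-local)
open import Data.List.Membership.Propositional using (_∈_; _∉_; _─_; find; lose)
open import Data.List.Membership.Propositional.Properties using (∈-++⁺ˡ; ∈-++⁺ʳ; ∈-filter⁻)
open import Data.List.Membership.DecPropositional _≟_ using (_∈?_)
open import Data.List.Relation.Binary.Subset.Propositional using (_⊆_)
open import Data.List.Relation.Unary.All using (all?)
import Data.List.Relation.Unary.All as All
import Data.List.Relation.Unary.All.Properties as All
open import Data.List.Relation.Unary.Any using (here; there; index)
import Data.List.Relation.Unary.Any as Any
import Data.List.Relation.Unary.Any.Properties as Any
open import Data.List.Relation.Unary.AllPairs using ([]; _∷_)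
open import Data.List.Relation.Unary.Unique.Propositional using (Unique)
import Data.List.Relation.Unary.Unique.Propositional.Properties as Unique
open import Data.Product using (_,_; proj₁; proj₂)
open import Data.Sum using (inj₁; inj₂)
open import Function using (_∘_; id)
open import Function.Bundles using (Equivalence)
open import Relation.Nullary using (yes; no; contradiction)
open import Relation.Nullary.Decidable using (T?)
open import Relation.Binary.PropositionalEquality using (refl; sym; trans; cong; subst; _≢_; ≢-sym; module ≡-Reasoning)

-- Let Levels be the first 2^i levels n > i at which A_i meets B^n, and X_i the least
-- elements of A_i on these levels.  For large k and s the approximation A_i(·,k,s) is
-- correct on all x < 2^N, N bounding Levels, so C_i(k,s) = Levels.  Each C_j(k,s) has at
-- most 2^j elements, so the C_j with j < i have fewer than 2^i together and some n in
-- Levels lies in none of them.  Then j(n,w) = i, and R(n,w) is the least element of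
-- A_i ∩ B^n, which lies in X_i.

2^[1+n]≡2^n+2^n : ∀ n → 2 ^ suc n ≡ 2 ^ n + 2 ^ n
2^[1+n]≡2^n+2^n n = cong (2 ^ n +_) (+-identityʳ (2 ^ n))

⌊n/2⌋<m : ∀ {n} m → n < m + m → ⌊ n /2⌋ < m
⌊n/2⌋<m zero ()
⌊n/2⌋<m {zero} (suc m) _ = z<s
⌊n/2⌋<m {suc zero} (suc m) _ = z<s
⌊n/2⌋<m {suc (suc n)} (suc m) (s<s n+1<m+[1+m]) =
  s<s (⌊n/2⌋<m m (s<s⁻¹ (subst (suc n <_) (+-suc m m) n+1<m+[1+m])))

μ-≤ : ∀ n {x} → x < 2 ^ suc n → μ x ≤ n
μ-≤ zero {0} _ = z≤n
μ-≤ zero {1} _ = z≤n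
μ-≤ zero {suc (suc x)} (s<s (s<s ()))
μ-≤ (suc n) {x} x<2^[2+n] = begin
  μ x               ≤⟨ m≤n+m∸n (μ x) 1 ⟩
  suc (μ x ∸ 1)     ≡⟨ cong suc (⌊log₂⌊n/2⌋⌋≡⌊log₂n⌋∸1 x) ⟨
  suc (μ ⌊ x /2⌋)   ≤⟨ s≤s (μ-≤ n ⌊x/2⌋<2^[1+n]) ⟩
  suc n             ∎
  where
  open ≤-Reasoning
  ⌊x/2⌋<2^[1+n] : ⌊ x /2⌋ < 2 ^ suc n
  ⌊x/2⌋<2^[1+n] = ⌊n/2⌋<m (2 ^ suc n) (subst (x <_) (2^[1+n]≡2^n+2^n (suc n)) x<2^[2+n])

μ-≥ : ∀ n {x} → 2 ^ n ≤ x → n ≤ μ x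
μ-≥ n {x} 2^n≤x = subst (_≤ μ x) (⌊log₂[2^n]⌋≡n n) (⌊log₂⌋-mono-≤ 2^n≤x)

μ-≡ : ∀ n {x} → 2 ^ n ≤ x → x < 2 ^ suc n → μ x ≡ n
μ-≡ n 2^n≤x x<2^[1+n] = ≤-antisym (μ-≤ n x<2^[1+n]) (μ-≥ n 2^n≤x)

binary-level : ∀ x → 1 ≤ x → ∃[ n ] (2 ^ n ≤ x × x < 2 ^ suc n)
binary-level (suc zero) _ = 0 , s≤s z≤n , s≤s (s≤s z≤n)
binary-level (suc (suc x)) _ with binary-level (suc x) (s≤s z≤n)
... | n , 2^n≤x+1 , x+1<2^[1+n] with m≤n⇒m<n∨m≡n x+1<2^[1+n]
...   | inj₁ x+2<2^[1+n] = n , m≤n⇒m≤1+n 2^n≤x+1 , x+2<2^[1+n]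
...   | inj₂ x+2≡2^[1+n] = suc n , ≤-reflexive (sym x+2≡2^[1+n]) ,
        subst (_< 2 ^ suc (suc n)) (sym x+2≡2^[1+n]) (^-monoʳ-< 2 (s≤s (s≤s z≤n)) (n<1+n (suc n)))

∈-range⁻ : ∀ a len {x} → x ∈ range a len → a ≤ x × x < a + len
∈-range⁻ a (suc len) (here refl) = ≤-refl , m<m+n a z<s
∈-range⁻ a (suc len) {x} (there x∈) with ∈-range⁻ (suc a) len x∈
... | a<x , x<1+a+len = <⇒≤ a<x , subst (x <_) (sym (+-suc a len)) x<1+a+len

∈-range⁺ : ∀ a len {x} → a ≤ x → x < a + len → x ∈ range a len
∈-range⁺ a zero {x} a≤x x<a+0 = contradiction (subst (x <_) (+-identityʳ a) x<a+0) (≤⇒≯ a≤x)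
∈-range⁺ a (suc len) {x} a≤x x<a+[1+len] with m≤n⇒m<n∨m≡n a≤x
... | inj₂ a≡x = here (sym a≡x)
... | inj₁ a<x = there (∈-range⁺ (suc a) len a<x (subst (x <_) (+-suc a len) x<a+[1+len]))

range-++ : ∀ a L e → range a (L + e) ≡ range a L ++ range (a + L) e
range-++ a zero e = cong (λ b → range b e) (sym (+-identityʳ a))
range-++ a (suc L) e =
  cong (a ∷_) (trans (range-++ (suc a) L e) (cong (λ b → range (suc a) L ++ range b e) (sym (+-suc a L))))

range-unique : ∀ a len → Unique (range a len)
range-unique a zero = []
range-unique a (suc len) =
  All.tabulate (λ y∈ → <⇒≢ (proj₁ (∈-range⁻ (suc a) len y∈))) ∷ range-unique (suc a) len

∈-Blist⁻ : ∀ n {x} → x ∈ Blist n → 2 ^ n ≤ x × x < 2 ^ suc n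
∈-Blist⁻ n {x} x∈ with ∈-range⁻ (2 ^ n) (2 ^ n) x∈
... | 2^n≤x , x<2^n+2^n = 2^n≤x , subst (x <_) (sym (2^[1+n]≡2^n+2^n n)) x<2^n+2^n

∈-Blist⁺ : ∀ n {x} → 2 ^ n ≤ x → x < 2 ^ suc n → x ∈ Blist n
∈-Blist⁺ n {x} 2^n≤x x<2^[1+n] = ∈-range⁺ (2 ^ n) (2 ^ n) 2^n≤x (subst (x <_) (2^[1+n]≡2^n+2^n n) x<2^[1+n])

μ-∈Blist : ∀ n {x} → x ∈ Blist n → μ x ≡ n
μ-∈Blist n x∈ = μ-≡ n (proj₁ (∈-Blist⁻ n x∈)) (proj₂ (∈-Blist⁻ n x∈))

∈-Blist⇒positive : ∀ n {x} → x ∈ Blist n → 1 ≤ x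
∈-Blist⇒positive n x∈ = ≤-trans (m^n>0 2 n) (proj₁ (∈-Blist⁻ n x∈))

∈-Blist-μ : ∀ {x} → 1 ≤ x → x ∈ Blist (μ x)
∈-Blist-μ {x} 1≤x with binary-level x 1≤x
... | n , 2^n≤x , x<2^[1+n] = subst (λ m → x ∈ Blist m) (sym (μ-≡ n 2^n≤x x<2^[1+n])) (∈-Blist⁺ n 2^n≤x x<2^[1+n])

any-true : ∀ {p : ℕ → Bool} {x xs} → x ∈ xs → p x ≡ true → any p xs ≡ true
any-true {p} x∈ px = Equivalence.to T-≡ (Any.any⁺ p (lose x∈ (Equivalence.from T-≡ px)))

any-cong-local : ∀ {p q : ℕ → Bool} {xs} → All (λ x → p x ≡ q x) xs → any p xs ≡ any q xs
any-cong-local p≗q = cong or (map-cong-local p≗q)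

memᵇ-∈ : ∀ {n xs} → n ∈ xs → memᵇ n xs ≡ true
memᵇ-∈ {n} n∈ = any-true n∈ (Equivalence.to T-≡ (≡⇒≡ᵇ n n refl))

memᵇ-∉ : ∀ {n xs} → n ∉ xs → memᵇ n xs ≡ false
memᵇ-∉ {n} {xs} n∉ with memᵇ n xs in eq
... | false = refl
... | true = contradiction
  (Any.map (λ {m} → sym ∘ ≡ᵇ⇒≡ m n) (Any.any⁻ _ xs (Equivalence.from T-≡ eq))) n∉

filterᵇ-cong-local : ∀ {p q : ℕ → Bool} {xs} → All (λ x → p x ≡ q x) xs → filterᵇ p xs ≡ filterᵇ q xs
filterᵇ-cong-local All.[] = refl
filterᵇ-cong-local {p} {q} {x ∷ xs} (px≡qx All.∷ p≗q) with p x | q x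
... | true | true = cong (x ∷_) (filterᵇ-cong-local p≗q)
... | false | false = filterᵇ-cong-local p≗q
filterᵇ-cong-local (() All.∷ _) | true | false
filterᵇ-cong-local (() All.∷ _) | false | true

firstOr-cong-local : ∀ {p q : ℕ → Bool} {d xs} → All (λ x → p x ≡ q x) xs → firstOr p d xs ≡ firstOr q d xs
firstOr-cong-local All.[] = refl
firstOr-cong-local {p} {q} {d} {x ∷ xs} (px≡qx All.∷ p≗q)
  rewrite px≡qx | firstOr-cong-local {p} {q} {d} p≗q = refl

firstOr-satisfies : ∀ {p : ℕ → Bool} {d} xs → any p xs ≡ true → firstOr p d xs ∈ xs × p (firstOr p d xs) ≡ true
firstOr-satisfies {p} (y ∷ ys) found with p y in py
... | true = here refl , py
... | false with firstOr-satisfies ys found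
...   | z∈ys , pz = there z∈ys , pz

firstOr-default : ∀ {p : ℕ → Bool} {d d′} xs → any p xs ≡ true → firstOr p d xs ≡ firstOr p d′ xs
firstOr-default {p} (y ∷ ys) found with p y
... | true = refl
... | false = firstOr-default ys found

firstOr-applyUpTo : ∀ {p : ℕ → Bool} {d} (f : ℕ → ℕ) {j n} → j < n → p (f j) ≡ true →
  (∀ {j′} → j′ < j → p (f j′) ≡ false) → firstOr p d (applyUpTo f n) ≡ f j
firstOr-applyUpTo f {zero} {suc n} _ pfj _ rewrite pfj = refl
firstOr-applyUpTo {p} f {suc j} {suc n} (s<s j<n) pfj earlier rewrite earlier {zero} z<s =
  firstOr-applyUpTo (f ∘ suc) j<n pfj (earlier ∘ s<s)

take-++ : ∀ {A : Set} m {xs ys : List A} → m ≤ length xs → take m (xs ++ ys) ≡ take m xs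
take-++ zero _ = refl
take-++ (suc m) {x ∷ xs} (s≤s m≤) = cong (x ∷_) (take-++ m m≤)

∈-take : ∀ {A : Set} m {xs : List A} {x} → x ∈ take m xs → x ∈ xs
∈-take (suc m) {_ ∷ _} (here x≡y) = here x≡y
∈-take (suc m) {_ ∷ _} (there x∈) = there (∈-take m x∈)

∈-─ : ∀ {A : Set} {x y : A} {ys} (x∈ys : x ∈ ys) → y ∈ ys → y ≢ x → y ∈ ys ─ x∈ys
∈-─ (here refl) (here refl) y≢x = contradiction refl y≢x
∈-─ (here refl) (there y∈) _ = y∈
∈-─ (there x∈) (here refl) _ = here refl
∈-─ (there x∈) (there y∈) y≢x = there (∈-─ x∈ y∈ y≢x)

Unique-⊆⇒length-≤ : ∀ {A : Set} {xs ys : List A} → Unique xs → xs ⊆ ys → length xs ≤ length ys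
Unique-⊆⇒length-≤ [] _ = z≤n
Unique-⊆⇒length-≤ {ys = ys} (x≢xs ∷ xs-unique) xs⊆ys =
  subst (_ ≤_) (sym (length-removeAt′ ys (index x∈ys)))
    (s≤s (Unique-⊆⇒length-≤ xs-unique (λ y∈ → ∈-─ x∈ys (xs⊆ys (there y∈)) (≢-sym (All.lookup x≢xs y∈)))))
  where
  x∈ys : _ ∈ ys
  x∈ys = xs⊆ys (here refl)

pigeonhole : ∀ {xs ys : List ℕ} → Unique xs → length ys < length xs → ∃[ x ] (x ∈ xs × x ∉ ys)
pigeonhole {xs} {ys} xs-unique |ys|<|xs| with all? (_∈? ys) xs
... | yes xs⊆ys = contradiction (Unique-⊆⇒length-≤ xs-unique (All.lookup xs⊆ys)) (<⇒≱ |ys|<|xs|)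
... | no xs⊈ys = find (All.¬All⇒Any¬ (_∈? ys) xs xs⊈ys)

hits : (ℕ → Bool) → ℕ → ℕ → ℕ
hits p a L = length (filterᵇ p (range a L))

hits-+ : ∀ (p : ℕ → Bool) a L e → hits p a (L + e) ≡ hits p a L + hits p (a + L) e
hits-+ p a L e = begin
  length (filterᵇ p (range a (L + e)))                        ≡⟨ cong (length ∘ filterᵇ p) (range-++ a L e) ⟩
  length (filterᵇ p (range a L ++ range (a + L) e))            ≡⟨ cong length (filter-++ (T? ∘ p) (range a L) _) ⟩
  length (filterᵇ p (range a L) ++ filterᵇ p (range (a + L) e)) ≡⟨ length-++ (filterᵇ p (range a L)) ⟩
  hits p a L + hits p (a + L) e                                ∎
  where open ≡-Reasoning

hits-unbounded : ∀ {p : ℕ → Bool} → (∀ b → ∃[ n ] (b ≤ n × p n ≡ true)) → ∀ m a → ∃[ L ] (m ≤ hits p a L)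
hits-unbounded unbounded zero a = 0 , z≤n
hits-unbounded {p} unbounded (suc m) a with hits-unbounded unbounded m a
... | L , m≤ with unbounded (a + L)
...   | n , a+L≤n , pn = L + suc n , (begin
        suc m                              ≡⟨ +-comm 1 m ⟩
        m + 1                              ≤⟨ +-mono-≤ m≤ (filter-some (T? ∘ p) (lose n∈ (Equivalence.from T-≡ pn))) ⟩
        hits p a L + hits p (a + L) (suc n) ≡⟨ hits-+ p a L (suc n) ⟨
        hits p a (L + suc n)               ∎)
  where
  open ≤-Reasoning
  n∈ : n ∈ range (a + L) (suc n)
  n∈ = ∈-range⁺ (a + L) (suc n) a+L≤n (≤-<-trans (m≤n+m n (a + L)) (+-monoʳ-< (a + L) (n<1+n n)))

take-filterᵇ-range-stable : ∀ {p q : ℕ → Bool} m a L e → All (λ n → q n ≡ p n) (range a L) →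
  m ≤ hits p a L → take m (filterᵇ q (range a (L + e))) ≡ take m (filterᵇ p (range a L))
take-filterᵇ-range-stable {p} {q} m a L e q≗p long = begin
  take m (filterᵇ q (range a (L + e)))                              ≡⟨ cong (take m ∘ filterᵇ q) (range-++ a L e) ⟩
  take m (filterᵇ q (range a L ++ rest))                            ≡⟨ cong (take m) (filter-++ (T? ∘ q) (range a L) rest) ⟩
  take m (filterᵇ q (range a L) ++ filterᵇ q rest)                  ≡⟨ cong (λ l → take m (l ++ filterᵇ q rest)) (filterᵇ-cong-local q≗p) ⟩
  take m (filterᵇ p (range a L) ++ filterᵇ q rest)                  ≡⟨ take-++ m long ⟩
  take m (filterᵇ p (range a L))                                    ∎
  where
  open ≡-Reasoning
  rest : List ℕ
  rest = range (a + L) e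

doubleLim-uniform : ∀ {f : ℕ → ℕ → ℕ → Bool} {v : ℕ → Bool} → (∀ x → 1 ≤ x → DoubleLimIs (f x) (v x)) →
  ∀ M → ∃[ K ] (∀ k → K < k → ∃[ s₀ ] (∀ s → s₀ < s → ∀ x → 1 ≤ x → x ≤ M → f x k s ≡ v x))
doubleLim-uniform lim zero = 0 , λ _ _ → 0 , λ _ _ _ 1≤x x≤0 → contradiction (≤-trans 1≤x x≤0) λ ()
doubleLim-uniform {f} {v} lim (suc M) with lim (suc M) (s≤s z≤n) | doubleLim-uniform lim M
... | K₁ , lim₁ | K₂ , lim≤M = K₁ ⊔ K₂ , eventually
  where
  eventually : ∀ k → K₁ ⊔ K₂ < k → ∃[ s₀ ] (∀ s → s₀ < s → ∀ x → 1 ≤ x → x ≤ suc M → f x k s ≡ v x)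
  eventually k K<k with lim₁ k (≤-<-trans (m≤m⊔n K₁ K₂) K<k) | lim≤M k (≤-<-trans (m≤n⊔m K₁ K₂) K<k)
  ... | s₁ , conv₁ | s₂ , conv≤M = s₁ ⊔ s₂ , conv
    where
    conv : ∀ s → s₁ ⊔ s₂ < s → ∀ x → 1 ≤ x → x ≤ suc M → f x k s ≡ v x
    conv s s₀<s x 1≤x x≤1+M with m≤n⇒m<n∨m≡n x≤1+M
    ... | inj₁ x<1+M = conv≤M s (≤-<-trans (m≤n⊔m s₁ s₂) s₀<s) x 1≤x (s≤s⁻¹ x<1+M)
    ... | inj₂ refl = conv₁ s (≤-<-trans (m≤m⊔n s₁ s₂) s₀<s)

meetsB : (ℕ → Bool) → ℕ → Bool
meetsB χ n = any χ (Blist n)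

leastInB : (ℕ → Bool) → ℕ → ℕ
leastInB χ n = firstOr χ 0 (Blist n)

meetsB-unbounded : ∀ {χ} → Infinite χ → ∀ b → ∃[ n ] (b ≤ n × meetsB χ n ≡ true)
meetsB-unbounded inf b with inf (2 ^ b)
... | x , 2^b<x , 1≤x , χx = μ x , μ-≥ b (<⇒≤ 2^b<x) , any-true (∈-Blist-μ 1≤x) χx

leastInB-spec : ∀ {χ} n → meetsB χ n ≡ true → leastInB χ n ∈ˢ χ × μ (leastInB χ n) ≡ n
leastInB-spec n met with firstOr-satisfies (Blist n) met
... | x∈B , χx = (∈-Blist⇒positive n x∈B , χx) , μ-∈Blist n x∈B

module _ (Φ : Functionals) (H : HaltApprox) where

  Cset-below : ℕ → ℕ → ℕ → List ℕ
  Cset-below zero k s = []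
  Cset-below (suc m) k s = Cset-below m k s ++ Cset Φ H m k s

  length-Cset-below : ∀ m k s → length (Cset-below m k s) < 2 ^ m
  length-Cset-below zero k s = z<s
  length-Cset-below (suc m) k s = begin-strict
    length (Cset-below m k s ++ Cset Φ H m k s)          ≡⟨ length-++ (Cset-below m k s) ⟩
    length (Cset-below m k s) + length (Cset Φ H m k s)  <⟨ +-mono-<-≤ (length-Cset-below m k s) |Cₘ|≤2^m ⟩
    2 ^ m + 2 ^ m                                        ≡⟨ 2^[1+n]≡2^n+2^n m ⟨
    2 ^ suc m                                            ∎
    where
    open ≤-Reasoning
    |Cₘ|≤2^m : length (Cset Φ H m k s) ≤ 2 ^ m
    |Cₘ|≤2^m = subst (_≤ 2 ^ m) (sym (length-take (2 ^ m) _)) (m⊓n≤m (2 ^ m) _)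

  ∈-Cset-below : ∀ {j m k s n} → j < m → n ∈ Cset Φ H j k s → n ∈ Cset-below m k s
  ∈-Cset-below {m = suc m} j<1+m n∈Cⱼ with m<1+n⇒m<n∨m≡n j<1+m
  ... | inj₁ j<m = ∈-++⁺ˡ (∈-Cset-below j<m n∈Cⱼ)
  ... | inj₂ refl = ∈-++⁺ʳ _ n∈Cⱼ

  jsel-≡ : ∀ {i n k s} w → λ′ w ≡ k → μ w ≡ s → i < n →
    n ∈ Cset Φ H i k s → n ∉ Cset-below i k s → jsel Φ H n w ≡ i
  jsel-≡ w refl refl i<n n∈Cᵢ n∉C<ᵢ =
    firstOr-applyUpTo id i<n (memᵇ-∈ n∈Cᵢ) (λ j<i → memᵇ-∉ (n∉C<ᵢ ∘ ∈-Cset-below j<i))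

  R-≡-leastInB : ∀ {χ j n k s} w → λ′ w ≡ k → μ w ≡ s → jsel Φ H n w ≡ j →
    All (λ x → Aapx Φ H j x k s ≡ χ x) (Blist n) → meetsB χ n ≡ true → R Φ H n w ≡ leastInB χ n
  R-≡-leastInB {n = n} w refl refl refl A≗χ met =
    trans (firstOr-cong-local A≗χ) (firstOr-default (Blist n) met)

module Witness (Φ : Functionals) (H : HaltApprox) (i : ℕ) (χ : ℕ → Bool) (inf : Infinite χ) where

  private
    enough : ∃[ L ] (2 ^ i ≤ hits (meetsB χ) (suc i) L)
    enough = hits-unbounded (meetsB-unbounded inf) (2 ^ i) (suc i)

  L₀ : ℕ
  L₀ = proj₁ enough

  N : ℕ
  N = suc i + L₀

  Levels : List ℕ
  Levels = take (2 ^ i) (filterᵇ (meetsB χ) (range (suc i) L₀))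

  X : List ℕ
  X = map (leastInB χ) Levels

  ∈-Levels⁻ : ∀ {n} → n ∈ Levels → i < n × n < N × meetsB χ n ≡ true
  ∈-Levels⁻ n∈ with ∈-filter⁻ (T? ∘ meetsB χ) (∈-take (2 ^ i) n∈)
  ... | n∈range , met with ∈-range⁻ (suc i) L₀ n∈range
  ...   | i<n , n<N = i<n , n<N , Equivalence.to T-≡ met

  Levels-unique : Unique Levels
  Levels-unique = Unique.take⁺ (2 ^ i) (Unique.filter⁺ (T? ∘ meetsB χ) (range-unique (suc i) L₀))

  length-Levels : length Levels ≡ 2 ^ i
  length-Levels = trans (length-take (2 ^ i) _) (m≤n⇒m⊓n≡m (proj₂ enough))

  X⊆A : All (_∈ˢ χ) X
  X⊆A = All.map⁺ (All.tabulate (λ {n} n∈ → proj₁ (leastInB-spec n (proj₂ (proj₂ (∈-Levels⁻ n∈))))))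

  Cset-stable : ∀ {k s} → N ≤ s → (∀ {n} → n < N → aapx Φ H i n k s ≡ meetsB χ n) → Cset Φ H i k s ≡ Levels
  Cset-stable {k} {s} N≤s agree = begin
    Cset Φ H i k s                                       ≡⟨ cong (λ l → take (2 ^ i) (filterᵇ a (range (suc i) l))) (sym L₀+e≡) ⟩
    take (2 ^ i) (filterᵇ a (range (suc i) (L₀ + e)))    ≡⟨ take-filterᵇ-range-stable (2 ^ i) (suc i) L₀ e a≗met (proj₂ enough) ⟩
    Levels                                               ∎
    where
    open ≡-Reasoning
    a : ℕ → Bool
    a n = aapx Φ H i n k s
    e : ℕ
    e = s ∸ suc i ∸ L₀
    L₀+e≡ : L₀ + e ≡ s ∸ suc i
    L₀+e≡ = m+[n∸m]≡n (m+n≤o⇒m≤o∸n L₀ (subst (_≤ s) (+-comm (suc i) L₀) N≤s))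
    a≗met : All (λ n → a n ≡ meetsB χ n) (range (suc i) L₀)
    a≗met = All.tabulate (λ n∈ → agree (proj₂ (∈-range⁻ (suc i) L₀ n∈)))

  R-hits-X : ∀ {k s} w → λ′ w ≡ k → μ w ≡ s → N ≤ s →
    (∀ x → 1 ≤ x → x ≤ 2 ^ N → Aapx Φ H i x k s ≡ χ x) → Any (λ x → R Φ H (μ x) w ≡ x) X
  R-hits-X {k} {s} w λw≡k μw≡s N≤s agree
    with n , n∈Levels , n∉C<ᵢ ← pigeonhole Levels-unique (subst (_ <_) (sym length-Levels) (length-Cset-below Φ H i k s))
    with i<n , n<N , met ← ∈-Levels⁻ n∈Levels
    = Any.map⁺ (lose n∈Levels (trans (cong (λ m → R Φ H m w) (proj₂ (leastInB-spec n met))) Rn≡))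
    where
    A≗χ : ∀ {n} → n < N → All (λ x → Aapx Φ H i x k s ≡ χ x) (Blist n)
    A≗χ {n} n<N = All.tabulate λ x∈ →
      agree _ (∈-Blist⇒positive n x∈) (<⇒≤ (<-≤-trans (proj₂ (∈-Blist⁻ n x∈)) (^-monoʳ-≤ 2 n<N)))
    Cᵢ≡Levels : Cset Φ H i k s ≡ Levels
    Cᵢ≡Levels = Cset-stable N≤s (any-cong-local ∘ A≗χ)
    Rn≡ : R Φ H n w ≡ leastInB χ n
    Rn≡ = R-≡-leastInB Φ H {n = n} w λw≡k μw≡s
      (jsel-≡ Φ H w λw≡k μw≡s i<n (subst (n ∈_) (sym Cᵢ≡Levels) n∈Levels) n∉C<ᵢ) (A≗χ n<N) met

  eventually-R-hits-X : (∀ x → 1 ≤ x → DoubleLimIs (λ k s → Aapx Φ H i x k s) (χ x)) →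
    ∃[ K ] (∀ k → K < k → ∃[ sₖ ] (∀ s → sₖ < s → ∀ w → 1 ≤ w →
      λ′ w ≡ k → μ w ≡ s → Any (λ x → R Φ H (μ x) w ≡ x) X))
  eventually-R-hits-X lim with K , eventually ← doubleLim-uniform lim (2 ^ N) =
    K , λ k K<k → let s₀ , agree = eventually k K<k in
      s₀ ⊔ N , λ s s₀⊔N<s w _ λw≡k μw≡s →
        R-hits-X w λw≡k μw≡s (<⇒≤ (≤-<-trans (m≤n⊔m s₀ N) s₀⊔N<s)) (agree s (≤-<-trans (m≤m⊔n s₀ N) s₀⊔N<s))

mainTheorem16 : (Φ : Functionals) (H : HaltApprox) (i : ℕ) (χ : ℕ → Bool) →
    (∀ x → 1 ≤ x → DoubleLimIs (λ k s → Aapx Φ H i x k s) (χ x)) →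
    Infinite χ →
    WeakApartness χ →
    ∃[ X ] (All (λ x → x ∈ˢ χ) X ×
      ∃[ K ] (∀ k → K < k → ∃[ sₖ ] (∀ s → sₖ < s → ∀ w → 1 ≤ w →
        λ′ w ≡ k → μ w ≡ s → Any (λ x → R Φ H (μ x) w ≡ x) X)))
mainTheorem16 Φ H i χ lim inf _ = X , X⊆A , eventually-R-hits-X lim
  where open Witness Φ H i χ inf
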